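{- Let $\mathcal{Q}:\varphi$ be an SSAT formula with $\varphi$ in conjunctive normal form containing only non-tautological clauses. If the empty clause $\emptyset^p$ is derivable by S-resolution from $\mathcal{Q}:\varphi$, then $Pr(\mathcal{Q}:\varphi) = p$.
   Context: An SSAT formula is $\mathcal{Q} : \varphi$ where $\mathcal{Q} = Q_1x_1\ldots Q_nx_n$ is a prefix of quantified propositional variables, each $Q_i$ being either $\exists$ or a randomized quantifier $\mathsf{R}^{p_i}$ with rational $0<p_i<1$, and $\varphi$ is a propositional formula with $\mathrm{Var}(\varphi)\subseteq\{x_1,\dots,x_n\}$. Its maximum probability of satisfaction is defined recursively: $Pr(\varepsilon:\varphi)$ is $0$ if $\varphi$ is equivalent to false and $1$ if equivalent to true; $Pr(\exists x\,\mathcal{Q}':\varphi) = \max(Pr(\mathcal{Q}':\varphi[\mathrm{true}/x]),Pr(\mathcal{Q}':\varphi[\mathrm{false}/x]))$; $Pr(\mathsf{R}^p x\,\mathcal{Q}':\varphi) = p\,Pr(\mathcal{Q}':\varphi[\mathrm{true}/x]) + (1-p)\,Pr(\mathcal{Q}':\varphi[\mathrm{false}/x])$. A clause is a disjunction (identified with a set) of literals without repetitions; it is tautological if it is valid. For $\psi$ with variables among $x_1,\dots,x_n$, $\mathcal{Q}(\psi)$ is the shortest prefix $Q_1x_1\ldots Q_ix_i$ of $\mathcal{Q}$ containing all variables of $\psi$. For a non-tautological clause $c$, $\mathrm{ff}_c$ is the unique assignment on $\mathrm{Var}(c)$ falsifying $c$. S-resolution derives annotated clauses $c^p$ ($0\le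 p\le1$) by the rules: (R.1) for every clause $c$ of $\varphi$, derive $c^0$. (R.2) if $c$ is a non-tautological clause over literals of variables in $\mathrm{Var}(\varphi)$, $\mathcal{Q}(c) = Q_1x_1\ldots Q_ix_i$, and for every $\tau:\{x_1,\dots,x_i\}\to\{\mathrm{true},\mathrm{false}\}$ agreeing with $\mathrm{ff}_c$ on $\mathrm{Var}(c)$ the formula $\varphi[\tau(x_1)/x_1]\ldots[\tau(x_i)/x_i]$ is valid, derive $c^1$. (R.3) from derived $(c_1\vee\neg x)^{p_1}$ and $(c_2\vee x)^{p_2}$, where $Qx$ occurs in $\mathcal{Q}$ but not in $\mathcal{Q}(c_1\vee c_2)$ and $c_1\vee c_2$ is non-tautological, derive $(c_1\vee c_2)^p$ with $p=\max(p_1,p_2)$ if $Q=\exists$ and $p = p_x p_1 + (1-p_x)p_2$ if $Q = \mathsf{R}^{p_x}$. -}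

module Defs where

open import Data.Nat using (ℕ; zero; suc; _≤_)
open import Data.Fin using (Fin; zero; suc; toℕ; _≟_)
open import Data.Bool using (Bool; true; false; not; if_then_else_; _∧_; _∨_)
open import Data.Maybe using (Maybe; just; nothing)
open import Data.Vec using (Vec; []; _∷_; lookup)
open import Data.List using (List; []; _∷_)
open import Data.List.Membership.Propositional using (_∈_)
open import Data.Product using (Σ; _×_; _,_)
open import Data.Rational using (ℚ; 0ℚ; 1ℚ; _+_; _*_; _-_; _⊔_; _<_)
open import Relation.Binary.PropositionalEquality using (_≡_; _≢_)
open import Relation.Nullary using (does)

data Quant : Set where
  ∃q : Quant
  R  : (p : ℚ) → 0ℚ < p → p < 1ℚ → Quant

-- A prefix Q₁x₁…Qₙxₙ: variable x_{i+1} is  i : Fin n,  quantified by  lookup Q i.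
Prefix : ℕ → Set
Prefix n = Vec Quant n

-- A non-tautological clause without repeated literals (a set of
-- literals containing no complementary pair) over variables Fin n is
-- exactly a map assigning to each variable: absent (nothing), occurring
-- positively (just true) or occurring negatively (just false).

Clause : ℕ → Set
Clause n = Fin n → Maybe Bool

emptyClause : ∀ {n} → Clause n
emptyClause _ = nothing

InVar : ∀ {n} → Clause n → Fin n → Set
InVar c j = c j ≢ nothing

CNF : ℕ → Set
CNF n = List (Clause n)

InVarF : ∀ {n} → CNF n → Fin n → Set
InVarF φ j = Σ _ λ c → (c ∈ φ) × InVar c j

anyFin : ∀ {n} → (Fin n → Bool) → Bool
anyFin {zero}  f = false
anyFin {suc n} f = f zero ∨ anyFin (λ j → f (suc j))

litTrue : Maybe Bool → Bool → Bool
litTrue nothing  _ = false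
litTrue (just true)  v = v
litTrue (just false) v = not v

evalClause : ∀ {n} → Clause n → (Fin n → Bool) → Bool
evalClause c σ = anyFin (λ j → litTrue (c j) (σ j))

evalCNF : ∀ {n} → CNF n → (Fin n → Bool) → Bool
evalCNF []       σ = true
evalCNF (c ∷ φ) σ = evalClause c σ ∧ evalCNF φ σ

-- Maximum probability of satisfaction Pr(Q : φ), following the recursive
-- definition: the formula is represented by its truth function on the
-- values of the still-quantified variables; φ[b/x] is  f ∘ (b ∷_).

prGo : ∀ {k} → Vec Quant k → (Vec Bool k → Bool) → ℚ
prGo []            f = if f [] then 1ℚ else 0ℚ
prGo (∃q ∷ Q)      f = prGo Q (λ v → f (true ∷ v)) ⊔ prGo Q (λ v → f (false ∷ v))
prGo (R p _ _ ∷ Q) f = p * prGo Q (λ v → f (true ∷ v))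
                     + (1ℚ - p) * prGo Q (λ v → f (false ∷ v))

Pr : ∀ {n} → Prefix n → CNF n → ℚ
Pr Q φ = prGo Q (λ v → evalCNF φ (lookup v))

-- Q(c): length i of the shortest prefix Q₁x₁…Qᵢxᵢ containing Var(c).

scope : ∀ {n} → Clause n → ℕ
scope {zero}  c = 0
scope {suc n} c with scope (λ j → c (suc j))
... | suc s = suc (suc s)
... | zero with c zero
...   | just _  = 1
...   | nothing = 0

AgreesFF : ∀ {n} → Clause n → (Fin n → Bool) → Set
AgreesFF c τ = ∀ j b → c j ≡ just b → τ j ≡ not b

splice : ∀ {n} → ℕ → (Fin n → Bool) → (Fin n → Bool) → (Fin n → Bool)
splice i τ ρ j = if does (Data.Nat._<?_ (toℕ j) i) then τ j else ρ j

Compatible : ∀ {n} → Clause n → Clause n → Set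
Compatible c₁ c₂ = ∀ j b → c₁ j ≡ just b → c₂ j ≢ just (not b)

-- c₁ ∨ c₂ (set union; meaningful as a clause when Compatible).
_∪_ : ∀ {n} → Clause n → Clause n → Clause n
(c₁ ∪ c₂) j with c₁ j
... | just b  = just b
... | nothing = c₂ j

addLit : ∀ {n} → Fin n → Bool → Clause n → Clause n
addLit x b c j = if does (j ≟ x) then just b else c j

combine : Quant → ℚ → ℚ → ℚ
combine ∃q        p₁ p₂ = p₁ ⊔ p₂
combine (R p _ _) p₁ p₂ = p * p₁ + (1ℚ - p) * p₂

-- Clauses are sets of literals, so clauses are compared extensionally.
_≐_ : ∀ {n} → Clause n → Clause n → Set
c ≐ d = ∀ j → c j ≡ d j

data Derives {n} (Q : Prefix n) (φ : CNF n) : Clause n → ℚ → Set where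
  R1 : ∀ {c d} → d ∈ φ → c ≐ d → Derives Q φ c 0ℚ
  R2 : ∀ {c} →
       (∀ j → InVar c j → InVarF φ j) →
       (∀ τ → AgreesFF c τ → ∀ ρ → evalCNF φ (splice (scope c) τ ρ) ≡ true) →
       Derives Q φ c 1ℚ
  R3 : ∀ {d₁ d₂ c₁ c₂ c p₁ p₂} (x : Fin n) →
       Derives Q φ d₁ p₁ → d₁ ≐ addLit x false c₁ →
       Derives Q φ d₂ p₂ → d₂ ≐ addLit x true  c₂ →
       scope (c₁ ∪ c₂) ≤ toℕ x →
       Compatible c₁ c₂ →
       c ≐ (c₁ ∪ c₂) →
       Derives Q φ c (combine (lookup Q x) p₁ p₂)

-- Every derivable c^p satisfies an invariant: once the variables of Q(c) are fixed so
-- as to falsify c, the remaining game is worth exactly p.  (R.1) and (R.2) hold because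
-- φ is then constantly false, resp. true.  For (R.3), fixing x as well falsifies the
-- premise c₁ ∨ ¬x or c₂ ∨ x, whose prefix ends exactly at x, so the quantifier on x
-- combines p₁ and p₂; the quantifiers between Q(c₁ ∨ c₂) and x are harmless because
-- combine q a a = a.  The empty clause has the empty prefix, so its annotation is Pr(Q:φ).

module Submission where

open import Defs
open import Function using (_∘_; const)
open import Data.Nat using (ℕ; zero; suc; z≤n; s≤s) renaming (_≤_ to _≤ℕ_; _<_ to _<ℕ_)
open import Data.Nat.Base using (_<ᵇ_)
open import Data.Nat.Properties
  using (≤-antisym; <-≤-trans; n<1+n; n≤0⇒n≡0; n≮0; <⇒≢; m<n⇒m<1+n; <ᵇ⇒<)
open import Data.Fin using (Fin; zero; suc; toℕ; _≟_)
open import Data.Bool using (Bool; true; false; not; T; _∧_; _∨_)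
open import Data.Unit using (tt)
open import Data.Bool.Properties using (∧-zeroʳ)
open import Data.Maybe using (just; nothing)
open import Data.Vec using (Vec; []; _∷_; lookup)
open import Data.Vec.Functional using (tail; updateAt) renaming (_∷_ to _◂_)
open import Data.Vec.Functional.Properties using (updateAt-updates; updateAt-minimal)
open import Data.List using ([]; _∷_)
open import Data.List.Membership.Propositional using (_∈_)
open import Data.List.Relation.Unary.Any using (here; there)
open import Data.Sum using (_⊎_; inj₁; inj₂)
open import Data.Product using (_×_; _,_)
open import Data.Empty using (⊥-elim)
open import Data.Rational using (ℚ; 0ℚ; 1ℚ; _+_; _*_; _-_; -_)
open import Data.Rational.Properties
  using (⊔-idem; *-distribʳ-+; +-inverseʳ; *-identityˡ; +-assoc; +-comm; +-identityˡ)
open import Relation.Binary.PropositionalEquality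
open import Relation.Nullary using (yes; no)

combine-idem : ∀ q c → combine q c c ≡ c
combine-idem ∃q        c = ⊔-idem c
combine-idem (R p _ _) c = begin
  p * c + (1ℚ - p) * c ≡⟨ sym (*-distribʳ-+ c p (1ℚ - p)) ⟩
  (p + (1ℚ - p)) * c   ≡⟨ cong (_* c) p+[1-p]≡1 ⟩
  1ℚ * c               ≡⟨ *-identityˡ c ⟩
  c                    ∎
  where
  open ≡-Reasoning
  p+[1-p]≡1 : p + (1ℚ - p) ≡ 1ℚ
  p+[1-p]≡1 = begin
    p + (1ℚ - p)   ≡⟨ cong (p +_) (+-comm 1ℚ (- p)) ⟩
    p + (- p + 1ℚ) ≡⟨ sym (+-assoc p (- p) 1ℚ) ⟩
    (p - p) + 1ℚ   ≡⟨ cong (_+ 1ℚ) (+-inverseʳ p) ⟩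
    0ℚ + 1ℚ        ≡⟨ +-identityˡ 1ℚ ⟩
    1ℚ             ∎

prGo-step : ∀ {n} q (Q : Vec Quant n) f →
  prGo (q ∷ Q) f ≡ combine q (prGo Q (λ v → f (true ∷ v))) (prGo Q (λ v → f (false ∷ v)))
prGo-step ∃q        Q f = refl
prGo-step (R _ _ _) Q f = refl

truthValue : Bool → ℚ
truthValue true  = 1ℚ
truthValue false = 0ℚ

prGo-const : ∀ {n} (Q : Vec Quant n) f b → (∀ v → f v ≡ b) → prGo Q f ≡ truthValue b
prGo-const [] f true  h rewrite h [] = refl
prGo-const [] f false h rewrite h [] = refl
prGo-const (q ∷ Q) f b h = begin
  prGo (q ∷ Q) f                                  ≡⟨ prGo-step q Q f ⟩
  combine q (prGo Q _) (prGo Q _)                 ≡⟨ cong₂ (combine q) (branch true) (branch false) ⟩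
  combine q (truthValue b) (truthValue b)         ≡⟨ combine-idem q (truthValue b) ⟩
  truthValue b                                    ∎
  where
  open ≡-Reasoning
  branch : ∀ a → prGo Q (λ v → f (a ∷ v)) ≡ truthValue b
  branch a = prGo-const Q _ b (λ v → h (a ∷ v))

AgreeBelow : ∀ {n} → ℕ → (Fin n → Bool) → (Fin n → Bool) → Set
AgreeBelow i σ τ = ∀ j → toℕ j <ℕ i → σ j ≡ τ j

prAfter : ∀ {n} → ℕ → Vec Quant n → (Vec Bool n → Bool) → (Fin n → Bool) → ℚ
prAfter zero    Q       f τ = prGo Q f
prAfter (suc i) []      f τ = prGo [] f
prAfter (suc i) (q ∷ Q) f τ = prAfter i Q (λ v → f (τ zero ∷ v)) (tail τ)

prAfter-const : ∀ {n} i (Q : Vec Quant n) f τ b →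
  (∀ v → AgreeBelow i (lookup v) τ → f v ≡ b) → prAfter i Q f τ ≡ truthValue b
prAfter-const zero    Q       f τ b h = prGo-const Q f b (λ v → h v (λ _ ()))
prAfter-const (suc i) []      f τ b h = prGo-const [] f b (λ v → h v (λ ()))
prAfter-const (suc i) (q ∷ Q) f τ b h = prAfter-const i Q _ (tail τ) b λ v a →
  h (τ zero ∷ v) λ { zero _ → refl ; (suc j) (s≤s l) → a j l }

prAfter-lower : ∀ {n} s t (Q : Vec Quant n) f τ c → s ≤ℕ t →
  (∀ τ' → AgreeBelow s τ' τ → prAfter t Q f τ' ≡ c) → prAfter s Q f τ ≡ c
prAfter-lower zero    zero    Q       f τ c _ h = h τ (λ _ ())
prAfter-lower zero    (suc t) []      f τ c _ h = h τ (λ _ ())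
prAfter-lower zero    (suc t) (q ∷ Q) f τ c _ h = begin
  prGo (q ∷ Q) f                  ≡⟨ prGo-step q Q f ⟩
  combine q (prGo Q _) (prGo Q _) ≡⟨ cong₂ (combine q) (branch true) (branch false) ⟩
  combine q c c                   ≡⟨ combine-idem q c ⟩
  c                               ∎
  where
  open ≡-Reasoning
  branch : ∀ a → prGo Q (λ v → f (a ∷ v)) ≡ c
  branch a = prAfter-lower 0 t Q _ (tail τ) c z≤n (λ τ' _ → h (a ◂ τ') (λ _ ()))
prAfter-lower (suc s) (suc t) []      f τ c _       h = h τ (λ _ _ → refl)
prAfter-lower (suc s) (suc t) (q ∷ Q) f τ c (s≤s l) h =
  prAfter-lower s t Q _ (tail τ) c l λ τ' a →
    h (τ zero ◂ τ') λ { zero _ → refl ; (suc j) (s≤s m) → a j m }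

prAfter-split : ∀ {n} (x : Fin n) (Q : Vec Quant n) f τ →
  prAfter (toℕ x) Q f τ
    ≡ combine (lookup Q x) (prAfter (suc (toℕ x)) Q f (updateAt τ x (const true)))
                           (prAfter (suc (toℕ x)) Q f (updateAt τ x (const false)))
prAfter-split zero    (q ∷ Q) f τ = prGo-step q Q f
prAfter-split (suc x) (q ∷ Q) f τ = prAfter-split x Q _ (tail τ)

_⊆_ : ∀ {n} → Clause n → Clause n → Set
c ⊆ d = ∀ j b → c j ≡ just b → d j ≡ just b

≐⇒⊆ : ∀ {n} {c d : Clause n} → c ≐ d → c ⊆ d
≐⇒⊆ c≐d j b e = trans (sym (c≐d j)) e

≐-sym : ∀ {n} {c d : Clause n} → c ≐ d → d ≐ c
≐-sym c≐d j = sym (c≐d j)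

∪-⊆ˡ : ∀ {n} (c₁ c₂ : Clause n) → c₁ ⊆ (c₁ ∪ c₂)
∪-⊆ˡ c₁ c₂ j b e with c₁ j
∪-⊆ˡ c₁ c₂ j b refl | just .b = refl

∪-⊆ʳ : ∀ {n} (c₁ c₂ : Clause n) → Compatible c₁ c₂ → c₂ ⊆ (c₁ ∪ c₂)
∪-⊆ʳ c₁ c₂ compat j b e with c₁ j in e₁
... | nothing = e
... | just b₁ with b | b₁
...   | true  | true  = refl
...   | false | false = refl
...   | true  | false = ⊥-elim (compat j false e₁ e)
...   | false | true  = ⊥-elim (compat j true e₁ e)

addLit-just : ∀ {n} x b (c : Clause n) j {b'} → addLit x b c j ≡ just b' →
  (j ≡ x × b' ≡ b) ⊎ c j ≡ just b'
addLit-just x b c j e with j ≟ x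
addLit-just x b c j refl | yes j≡x = inj₁ (j≡x , refl)
addLit-just x b c j e    | no  _   = inj₂ e

scope-var : ∀ {n} (c : Clause n) j {b} → c j ≡ just b → toℕ j <ℕ scope c
scope-var {suc n} c j e with scope (tail c) in s≡
scope-var {suc n} c zero    e | suc s = s≤s z≤n
scope-var {suc n} c (suc j) e | suc s = s≤s (subst (toℕ j <ℕ_) s≡ (scope-var (tail c) j e))
scope-var {suc n} c (suc j) e | zero with () ← subst (toℕ j <ℕ_) s≡ (scope-var (tail c) j e)
scope-var {suc n} c zero    e | zero with c zero
scope-var {suc n} c zero refl | zero | just _ = s≤s z≤n

scope-least : ∀ {n} (c : Clause n) i → (∀ j b → c j ≡ just b → toℕ j <ℕ i) → scope c ≤ℕ i
scope-least {zero}  c i       h = z≤n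
scope-least {suc n} c zero    h with scope (tail c) | scope-least (tail c) 0 (λ j b e → ⊥-elim (n≮0 (h (suc j) b e)))
... | zero | _ with c zero in e
...   | nothing = z≤n
...   | just b with () ← h zero b e
scope-least {suc n} c (suc i) h with scope (tail c) | scope-least (tail c) i (λ j b e → lower (h (suc j) b e))
  where lower : ∀ {m} → suc m <ℕ suc i → m <ℕ i
        lower (s≤s l) = l
... | suc s | l = s≤s l
... | zero  | _ with c zero
...   | nothing = z≤n
...   | just _  = s≤s z≤n

scope-mono : ∀ {n} {c d : Clause n} → c ⊆ d → scope c ≤ℕ scope d
scope-mono {c = c} {d} c⊆d = scope-least c (scope d) (λ j b e → scope-var d j (c⊆d j b e))

scope-≐ : ∀ {n} {c d : Clause n} → c ≐ d → scope c ≡ scope d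
scope-≐ c≐d = ≤-antisym (scope-mono (≐⇒⊆ c≐d)) (scope-mono (≐⇒⊆ (≐-sym c≐d)))

scope-empty : ∀ n → scope {n} emptyClause ≡ 0
scope-empty n = n≤0⇒n≡0 (scope-least {n} emptyClause 0 (λ _ _ ()))

addLit-at : ∀ {n} x b (c : Clause n) → addLit x b c x ≡ just b
addLit-at x b c with x ≟ x
... | yes _  = refl
... | no x≢x = ⊥-elim (x≢x refl)

agreesFF-⊆ : ∀ {n} {c d : Clause n} {τ} → c ⊆ d → AgreesFF d τ → AgreesFF c τ
agreesFF-⊆ c⊆d ff j b e = ff j b (c⊆d j b e)

agreesFF-below : ∀ {n} {c : Clause n} {σ τ} → AgreesFF c τ → AgreeBelow (scope c) σ τ → AgreesFF c σ
agreesFF-below {c = c} ff a j b e = trans (a j (scope-var c j e)) (ff j b e)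

splice-agree : ∀ {n} {i} {σ τ : Fin n → Bool} → AgreeBelow i σ τ → ∀ j → splice i τ σ j ≡ σ j
splice-agree {i = i} a j with toℕ j <ᵇ i in j<ᵇi
... | true  = sym (a j (<ᵇ⇒< (toℕ j) i (subst T (sym j<ᵇi) tt)))
... | false = refl

anyFin-cong : ∀ {n} {f g : Fin n → Bool} → (∀ j → f j ≡ g j) → anyFin f ≡ anyFin g
anyFin-cong {zero}  e = refl
anyFin-cong {suc n} e = cong₂ _∨_ (e zero) (anyFin-cong (e ∘ suc))

anyFin-false : ∀ {n} {f : Fin n → Bool} → (∀ j → f j ≡ false) → anyFin f ≡ false
anyFin-false {zero}  e = refl
anyFin-false {suc n} e rewrite e zero = anyFin-false (e ∘ suc)

litTrue-ff : ∀ m v → (∀ b → m ≡ just b → v ≡ not b) → litTrue m v ≡ false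
litTrue-ff nothing      v h = refl
litTrue-ff (just true)  v h = h true refl
litTrue-ff (just false) v h rewrite h false refl = refl

evalClause-ff : ∀ {n} {c : Clause n} {σ} → AgreesFF c σ → evalClause c σ ≡ false
evalClause-ff {c = c} {σ} ff = anyFin-false (λ j → litTrue-ff (c j) (σ j) (ff j))

evalCNF-cong : ∀ {n} (φ : CNF n) {σ σ'} → (∀ j → σ j ≡ σ' j) → evalCNF φ σ ≡ evalCNF φ σ'
evalCNF-cong []      e = refl
evalCNF-cong (c ∷ φ) e = cong₂ _∧_ (anyFin-cong (λ j → cong (litTrue (c j)) (e j))) (evalCNF-cong φ e)

evalCNF-∈ : ∀ {n} {φ : CNF n} {d σ} → d ∈ φ → evalClause d σ ≡ false → evalCNF φ σ ≡ false
evalCNF-∈ (here refl) e rewrite e = refl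
evalCNF-∈ {φ = c ∷ φ} {σ = σ} (there d∈φ) e rewrite evalCNF-∈ d∈φ e = ∧-zeroʳ (evalClause c σ)

satFn : ∀ {n} → CNF n → Vec Bool n → Bool
satFn φ v = evalCNF φ (lookup v)

Sound : ∀ {n} → Prefix n → CNF n → Clause n → ℚ → Set
Sound Q φ c p = ∀ τ → AgreesFF c τ → prAfter (scope c) Q (satFn φ) τ ≡ p

sound-R1 : ∀ {n} {Q : Prefix n} {φ c d} → d ∈ φ → c ≐ d → Sound Q φ c 0ℚ
sound-R1 {Q = Q} {φ} {c} d∈φ c≐d τ ff = prAfter-const (scope c) Q (satFn φ) τ false λ v a →
  evalCNF-∈ d∈φ (evalClause-ff (agreesFF-⊆ (≐⇒⊆ (≐-sym c≐d)) (agreesFF-below ff a)))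

sound-R2 : ∀ {n} {Q : Prefix n} {φ c} →
  (∀ τ → AgreesFF c τ → ∀ ρ → evalCNF φ (splice (scope c) τ ρ) ≡ true) → Sound Q φ c 1ℚ
sound-R2 {Q = Q} {φ} {c} valid τ ff = prAfter-const (scope c) Q (satFn φ) τ true λ v a →
  trans (evalCNF-cong φ (λ j → sym (splice-agree a j))) (valid τ ff (lookup v))

sound-premise : ∀ {n} {Q : Prefix n} {φ d c' c p} x b σ →
  Sound Q φ d p → d ≐ addLit x b c' → c' ⊆ c → scope c ≤ℕ toℕ x →
  AgreesFF c σ → σ x ≡ not b → prAfter (suc (toℕ x)) Q (satFn φ) σ ≡ p
sound-premise {Q = Q} {φ} {d} {c'} {c} {p} x b σ sd d≐ c'⊆c sc≤x ff σx≡ =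
  subst (λ s → prAfter s Q (satFn φ) σ ≡ p) scope-d≡ (sd σ ff-d)
  where
  d-var : ∀ j b' → d j ≡ just b' → toℕ j <ℕ suc (toℕ x)
  d-var j b' e with addLit-just x b c' j (trans (sym (d≐ j)) e)
  ... | inj₁ (refl , _) = n<1+n (toℕ x)
  ... | inj₂ e'         = m<n⇒m<1+n (<-≤-trans (scope-var c j (c'⊆c j b' e')) sc≤x)
  scope-d≡ : scope d ≡ suc (toℕ x)
  scope-d≡ = ≤-antisym (scope-least d _ d-var) (scope-var d x (trans (d≐ x) (addLit-at x b c')))
  ff-d : AgreesFF d σ
  ff-d j b' e with addLit-just x b c' j (trans (sym (d≐ j)) e)
  ... | inj₁ (refl , refl) = σx≡
  ... | inj₂ e'            = ff j b' (c'⊆c j b' e')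

sound : ∀ {n} {Q : Prefix n} {φ c p} → Derives Q φ c p → Sound Q φ c p
sound (R1 d∈φ c≐d) = sound-R1 d∈φ c≐d
sound {φ = φ} (R2 _ valid) = sound-R2 {φ = φ} valid
sound {Q = Q} {φ} {c} (R3 {c₁ = c₁} {c₂} {p₁ = p₁} {p₂} x D₁ d₁≐ D₂ d₂≐ sc≤x compat c≐) τ ff =
  prAfter-lower (scope c) (toℕ x) Q (satFn φ) τ _ sc≤x' λ τ' a → begin
    prAfter (toℕ x) Q (satFn φ) τ'
      ≡⟨ prAfter-split x Q (satFn φ) τ' ⟩
    combine (lookup Q x) (prAfter (suc (toℕ x)) Q (satFn φ) (set τ' true))
                         (prAfter (suc (toℕ x)) Q (satFn φ) (set τ' false))
      ≡⟨ cong₂ (combine (lookup Q x))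
           (sound-premise {φ = φ} x false (set τ' true) (sound D₁) d₁≐ (⊆-resolvent (∪-⊆ˡ c₁ c₂)) sc≤x'
             (ff-set τ' a true) (updateAt-updates x τ'))
           (sound-premise {φ = φ} x true (set τ' false) (sound D₂) d₂≐ (⊆-resolvent (∪-⊆ʳ c₁ c₂ compat)) sc≤x'
             (ff-set τ' a false) (updateAt-updates x τ')) ⟩
    combine (lookup Q x) p₁ p₂ ∎
  where
  open ≡-Reasoning
  set : (Fin _ → Bool) → Bool → Fin _ → Bool
  set τ' b = updateAt τ' x (const b)
  sc≤x' : scope c ≤ℕ toℕ x
  sc≤x' = subst (_≤ℕ toℕ x) (sym (scope-≐ c≐)) sc≤x
  ⊆-resolvent : ∀ {c'} → c' ⊆ (c₁ ∪ c₂) → c' ⊆ c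
  ⊆-resolvent c'⊆ j b e = ≐⇒⊆ (≐-sym c≐) j b (c'⊆ j b e)
  ff-set : ∀ τ' → AgreeBelow (scope c) τ' τ → ∀ b → AgreesFF c (set τ' b)
  ff-set τ' a b = agreesFF-below ff λ j l →
    trans (updateAt-minimal j x τ' (<⇒≢ (<-≤-trans l sc≤x') ∘ cong toℕ)) (a j l)

corollary3p2 : (n : ℕ) (Q : Prefix n) (φ : CNF n) (p : ℚ) →
    Derives Q φ emptyClause p → Pr Q φ ≡ p
corollary3p2 n Q φ p D =
  subst (λ s → prAfter s Q (satFn φ) τ ≡ p) (scope-empty n) (sound D τ (λ _ _ ()))
  where
  τ : Fin n → Bool
  τ = const false
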